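{- Let $A_1, \ldots, A_m$ be FDDS and $P(X) = \sum_{i=1}^{m} A_i X^i$ (no constant term). If at least one $A_i$ is cancelable, then $P$ is injective: for all FDDS $X,Y$, $P(X) = P(Y)$ implies $X = Y$.
   Context: An FDDS is a pair $(S,f)$ with $S$ a finite (possibly empty) set and $f:S\to S$, up to isomorphism. Sum is disjoint union, product is the direct product $(S,f)\times(T,g)=(S\times T,(s,t)\mapsto(f(s),g(t)))$. An FDDS $A$ is cancelable if $AB=AC$ implies $B=C$ for all FDDS $B,C$ (equivalently, some connected component of $A$ contains a fixed point). -}

module Defs where

open import Data.Nat using (ℕ; zero; suc) renaming (_+_ to _+ℕ_; _*_ to _*ℕ_)
open import Data.Fin using (Fin; splitAt; join; combine; remQuot)
open import Data.Sum using (inj₁; inj₂; [_,_]′)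
open import Data.Sum.Base as Sum using ()
open import Data.Product using (_×_; _,_; proj₁; proj₂)
open import Data.List using (List; []; _∷_)
open import Relation.Binary.PropositionalEquality using (_≡_)

record FDDS : Set where
  constructor fdds
  field
    size : ℕ
    fun  : Fin size → Fin size
open FDDS public

record _≅_ (A B : FDDS) : Set where
  field
    to      : Fin (size A) → Fin (size B)
    from    : Fin (size B) → Fin (size A)
    from∘to : ∀ x → from (to x) ≡ x
    to∘from : ∀ y → to (from y) ≡ y
    commute : ∀ x → to (fun A x) ≡ fun B (to x)

infix 4 _≅_
infixl 6 _⊕_
infixl 7 _⊗_

𝟘 : FDDS
𝟘 = fdds 0 (λ ())

𝟙 : FDDS
𝟙 = fdds 1 (λ x → x)

_⊕_ : FDDS → FDDS → FDDS
A ⊕ B = fdds (size A +ℕ size B)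
  (λ x → join (size A) (size B) (Sum.map (fun A) (fun B) (splitAt (size A) x)))

_⊗_ : FDDS → FDDS → FDDS
A ⊗ B = fdds (size A *ℕ size B)
  (λ x → let p = remQuot {size A} (size B) x
         in combine (fun A (proj₁ p)) (fun B (proj₂ p)))

_^_ : FDDS → ℕ → FDDS
X ^ zero  = 𝟙
X ^ suc k = X ⊗ (X ^ k)

Cancelable : FDDS → Set
Cancelable A = ∀ (B C : FDDS) → A ⊗ B ≅ A ⊗ C → B ≅ C

evalFrom : ℕ → List FDDS → FDDS → FDDS
evalFrom k []       X = 𝟘
evalFrom k (A ∷ As) X = A ⊗ (X ^ k) ⊕ evalFrom (suc k) As X

evalPoly : List FDDS → FDDS → FDDS
evalPoly As X = evalFrom 1 As X

module Submission where

-- For a finite digraph Z let hom Z U be the number of homomorphisms from Z into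
-- the functional graph of U.  It is multiplicative in U, and additive when Z is
-- connected, so for connected Z the count hom Z (P X) is the ℕ-polynomial with
-- coefficients hom Z Aᵢ evaluated at hom Z X.  Let A be a cancelable coefficient.
-- If hom Z A > 0 this polynomial has a positive coefficient and no constant
-- term, hence is strictly increasing, and P X ≅ P Y gives hom Z X = hom Z Y;
-- either way hom Z (A ⊗ X) = hom Z (A ⊗ Y).  Counts of a disconnected digraph
-- are products of counts of smaller ones, so this holds for every Z.  By
-- Lovász's deletion–contraction argument, the numbers of homomorphisms that
-- separate prescribed pairs of vertices agree as well; for the functional graph
-- of A ⊗ X and all pairs, the identity then yields an injective homomorphism
-- into A ⊗ Y, i.e. an isomorphism.  Cancelling A gives X ≅ Y.

open import Defs
open import Data.Bool using (Bool; true; false; T)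
open import Data.Bool.Properties using () renaming (_≟_ to _≟ᵇ_)
open import Data.Empty using (⊥-elim; ⊥-elim-irr)
open import Data.Fin using (Fin; zero; suc; splitAt; join; combine; remQuot; punchIn; punchOut)
open import Data.Fin.Properties
  using (_≟_; 2↔Bool; +↔⊎; *↔×; cantor-schröder-bernstein; injective⇒≤; any?; all?;
         splitAt-join; join-splitAt; remQuot-combine; combine-remQuot; ↑ˡ-injective; ↑ʳ-injective;
         punchInᵢ≢i; punchIn-punchOut; punchOut-punchIn; punchOut-cong; punchOut-injective)
open import Data.Irrelevant using (Irrelevant; [_])
open import Data.List using (List; []; _∷_; map; filter; cartesianProduct; allFin)
open import Data.List.Membership.Propositional using (_∈_; find; lose)
open import Data.List.Membership.Propositional.Properties
  using (∈-map⁺; ∈-filter⁺; ∈-cartesianProduct⁺; ∈-allFin)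
open import Data.List.Relation.Unary.All as All using (All; []; _∷_)
open import Data.List.Relation.Unary.All.Properties using (map⁺; map⁻; all-filter)
open import Data.List.Relation.Unary.Any using (Any; here; there)
open import Data.Nat using (ℕ; zero; suc; _+_; _*_; _≤_; _<_; z≤n; z<s) renaming (_^_ to _^ℕ_)
open import Data.Nat.Induction using (<-rec)
open import Data.Nat.Properties
  using (≤-trans; ≤-reflexive; 1+n≰n; <⇒≤; <⇒≢; <-cmp; m<m+n; m<n+m; +-cancelʳ-≡;
         +-mono-≤; +-mono-<-≤; +-mono-≤-<; *-monoʳ-≤; *-monoʳ-<; ^-monoˡ-≤; ^-monoˡ-<)
open import Data.Product as Product using (∃; ∃-syntax; _×_; _,_; proj₁; proj₂; uncurry)
open import Data.Product.Function.NonDependent.Propositional using (_×-↔_)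
open import Data.Refinement using (Refinement-syntax; _,_; value; value-injective)
open import Data.Sum as Sum using (_⊎_; inj₁; inj₂; [_,_]′)
open import Data.Sum.Function.Propositional using (_⊎-↔_)
open import Data.Vec using (Vec; []; _∷_; uncons; lookup; tabulate)
open import Data.Vec.Properties using (lookup∘tabulate; tabulate∘lookup; tabulate-cong)
open import Function using (_∘_; _$_)
open import Function.Bundles using (_↔_; mk↔ₛ′; Inverse; Injection)
open import Function.Definitions using (Injective)
open import Function.Properties.Inverse using (↔-refl; ↔-sym; ↔-trans; ↔⇒↣)
open import Relation.Binary.Core using (_Preserves_⟶_)
open import Relation.Binary.Definitions using (tri<; tri≈; tri>)
open import Relation.Binary.PropositionalEquality
  using (_≡_; _≢_; _≗_; refl; sym; trans; cong; cong₂; subst; subst₂; module ≡-Reasoning)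
open import Relation.Nullary using (¬_; contradiction)
open import Relation.Nullary.Decidable
  using (Dec; yes; no; map′; recompute; ¬?; _×-dec_; _→-dec_; T?; ⌊_⌋; toWitness; fromWitness)
open import Relation.Unary using (Decidable)

open Inverse using (to; from; strictlyInverseˡ; strictlyInverseʳ)

private
  variable
    A B : Set
    k m n : ℕ

-- Finite types

Finite : Set → Set
Finite A = ∃[ n ] A ↔ Fin n

card : Finite A → ℕ
card = proj₁

card-cong : (fa : Finite A) (fb : Finite B) → A ↔ B → card fa ≡ card fb
card-cong (a , ea) (b , eb) e =
  cantor-schröder-bernstein (Injection.injective (↔⇒↣ φ)) (Injection.injective (↔⇒↣ (↔-sym φ)))
  where
  φ : Fin a ↔ Fin b
  φ = ↔-trans (↔-sym ea) (↔-trans e eb)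

card-≡⇒↔ : (fa : Finite A) (fb : Finite B) → card fa ≡ card fb → A ↔ B
card-≡⇒↔ (_ , ea) (_ , eb) refl = ↔-trans ea (↔-sym eb)

finite-↔ : A ↔ B → Finite B → Finite A
finite-↔ e (n , eb) = n , ↔-trans e eb

finite-Fin : Finite (Fin n)
finite-Fin = _ , ↔-refl

finite-⊎ : Finite A → Finite B → Finite (A ⊎ B)
finite-⊎ (m , ea) (n , eb) = m + n , ↔-trans (ea ⊎-↔ eb) (↔-sym +↔⊎)

finite-× : Finite A → Finite B → Finite (A × B)
finite-× (m , ea) (n , eb) = m * n , ↔-trans (ea ×-↔ eb) (↔-sym *↔×)

finite-Vec : Finite A → ∀ n → Finite (Vec A n)
finite-Vec     fa zero    = 1 , mk↔ₛ′ (λ _ → zero) (λ _ → []) (λ { zero → refl }) (λ { [] → refl })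
finite-Vec {A} fa (suc n) = finite-↔ Vec-suc↔ (finite-× fa (finite-Vec fa n))
  where
  Vec-suc↔ : Vec A (suc n) ↔ (A × Vec A n)
  Vec-suc↔ = mk↔ₛ′ uncons (uncurry _∷_) (λ _ → refl) (λ { (x ∷ xs) → refl })

finite-Irrelevant : {P : Set} → Dec P → Finite (Irrelevant P)
finite-Irrelevant (yes p) = 1 , mk↔ₛ′ (λ _ → zero) (λ _ → [ p ]) (λ { zero → refl }) (λ _ → refl)
finite-Irrelevant (no ¬p) = 0 , mk↔ₛ′
  (λ { [ p ] → ⊥-elim-irr (¬p p) }) (λ ()) (λ ()) (λ { [ p ] → ⊥-elim-irr (¬p p) })

module _ {P : Fin (suc n) → Set} where
  private
    peel : [ i ∈ Fin (suc n) ∣ P i ] → Irrelevant (P zero) ⊎ [ i ∈ Fin n ∣ P (suc i) ]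
    peel (zero  , p) = inj₁ p
    peel (suc i , p) = inj₂ (i , p)

    unpeel : Irrelevant (P zero) ⊎ [ i ∈ Fin n ∣ P (suc i) ] → [ i ∈ Fin (suc n) ∣ P i ]
    unpeel (inj₁ p)       = zero , p
    unpeel (inj₂ (i , p)) = suc i , p

  refinement-Fin-suc↔ : [ i ∈ Fin (suc n) ∣ P i ] ↔ (Irrelevant (P zero) ⊎ [ i ∈ Fin n ∣ P (suc i) ])
  refinement-Fin-suc↔ = mk↔ₛ′ peel unpeel
    (λ { (inj₁ _) → refl ; (inj₂ _) → refl }) (λ { (zero , _) → refl ; (suc _ , _) → refl })

finite-refinement-Fin : {P : Fin n → Set} → Decidable P → Finite [ i ∈ Fin n ∣ P i ]
finite-refinement-Fin {zero}  _  = 0 , mk↔ₛ′ (λ { (() , _) }) (λ ()) (λ ()) (λ { (() , _) })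
finite-refinement-Fin {suc n} P? = finite-↔ refinement-Fin-suc↔
  (finite-⊎ (finite-Irrelevant (P? zero)) (finite-refinement-Fin (P? ∘ suc)))

refinement-↔ : {P : A → Set} (e : A ↔ B) → [ a ∈ A ∣ P a ] ↔ [ b ∈ B ∣ P (from e b) ]
refinement-↔ {P = P} e = mk↔ₛ′
  (λ (a , [ p ]) → to e a , [ subst P (sym (strictlyInverseʳ e a)) p ])
  (λ (b , p) → from e b , p)
  (λ (b , _) → value-injective (strictlyInverseˡ e b))
  (λ (a , _) → value-injective (strictlyInverseʳ e a))

finite-refinement : {P : A → Set} → Finite A → Decidable P → Finite [ a ∈ A ∣ P a ]
finite-refinement (n , e) P? = finite-↔ (refinement-↔ e) (finite-refinement-Fin (P? ∘ from e))

finite-inhabited : Finite A → A → ∃[ n ] A ↔ Fin (suc n)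
finite-inhabited (zero  , e) a with () ← to e a
finite-inhabited (suc n , e) _ = n , e

any?-finite : {P : A → Set} → Finite A → Decidable P → Dec (∃ P)
any?-finite {P = P} (n , e) P? = map′
  (λ (i , p) → from e i , p) (λ (a , p) → to e a , subst P (sym (strictlyInverseʳ e a)) p)
  (any? (P? ∘ from e))

injective⇒surjective : {f : Fin m → Fin n} → Injective _≡_ _≡_ f → n ≤ m → ∀ y → ∃ λ x → f x ≡ y
injective⇒surjective {m} {suc n} {f} f-injective n≤m y with any? (λ x → f x ≟ y)
... | yes hit = hit
... | no ¬hit = contradiction (≤-trans n≤m (injective⇒≤ g-injective)) 1+n≰n
  where
  g : Fin m → Fin n
  g x = punchOut {i = y} λ y≡fx → ¬hit (x , sym y≡fx)
  g-injective : Injective _≡_ _≡_ g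
  g-injective gx≡gx′ = f-injective (punchOut-injective {i = y} _ _ gx≡gx′)

isLeft : A ⊎ B → Bool
isLeft (inj₁ _) = true
isLeft (inj₂ _) = false

isLeft-map : ∀ {C D : Set} {f : A → C} {g : B → D} s → isLeft (Sum.map f g s) ≡ isLeft s
isLeft-map (inj₁ _) = refl
isLeft-map (inj₂ _) = refl

fromLeft : (s : A ⊎ B) → isLeft s ≡ true → A
fromLeft (inj₁ a) _ = a

fromRight : (s : A ⊎ B) → isLeft s ≡ false → B
fromRight (inj₂ b) _ = b

inj₁-fromLeft : ∀ (s : A ⊎ B) p → inj₁ (fromLeft s p) ≡ s
inj₁-fromLeft (inj₁ _) _ = refl

inj₂-fromRight : ∀ (s : A ⊎ B) p → inj₂ (fromRight s p) ≡ s
inj₂-fromRight (inj₂ _) _ = refl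

module _ (c : A → Bool) where
  private
    classify : ∀ a b → c a ≡ b → [ a ∈ A ∣ c a ≡ true ] ⊎ [ a ∈ A ∣ c a ≡ false ]
    classify a true  ca = inj₁ (a , [ ca ])
    classify a false ca = inj₂ (a , [ ca ])

    true≢false : true ≢ false
    true≢false ()

    classify-value : ∀ s b ca → classify ([ value , value ]′ s) b ca ≡ s
    classify-value (inj₁ _)            true  _   = refl
    classify-value (inj₂ _)            false _   = refl
    classify-value (inj₁ (_ , [ ca ])) false ca′ = ⊥-elim-irr (true≢false (trans (sym ca) ca′))
    classify-value (inj₂ (_ , [ ca ])) true  ca′ = ⊥-elim-irr (true≢false (trans (sym ca′) ca))

    value-classify : ∀ a b ca → [ value , value ]′ (classify a b ca) ≡ a
    value-classify a true  _ = refl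
    value-classify a false _ = refl

    isLeft-classify : ∀ a b ca → isLeft (classify a b ca) ≡ b
    isLeft-classify a true  _ = refl
    isLeft-classify a false _ = refl

  partition-↔ : A ↔ ([ a ∈ A ∣ c a ≡ true ] ⊎ [ a ∈ A ∣ c a ≡ false ])
  partition-↔ = mk↔ₛ′ (λ a → classify a (c a) refl) [ value , value ]′
    (λ s → classify-value s _ refl) (λ a → value-classify a _ refl)

  isLeft-partition : ∀ a → isLeft (to partition-↔ a) ≡ c a
  isLeft-partition a = isLeft-classify a _ refl

-- Polynomials over ℕ

evalFromℕ : ℕ → List ℕ → ℕ → ℕ
evalFromℕ k []       x = 0
evalFromℕ k (c ∷ cs) x = c * x ^ℕ k + evalFromℕ (suc k) cs x

evalFromℕ-mono-≤ : ∀ k cs → evalFromℕ k cs Preserves _≤_ ⟶ _≤_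
evalFromℕ-mono-≤ k []       _   = z≤n
evalFromℕ-mono-≤ k (c ∷ cs) x≤y =
  +-mono-≤ (*-monoʳ-≤ c (^-monoˡ-≤ k x≤y)) (evalFromℕ-mono-≤ (suc k) cs x≤y)

evalFromℕ-mono-< : ∀ k cs → Any (0 <_) cs → evalFromℕ (suc k) cs Preserves _<_ ⟶ _<_
evalFromℕ-mono-< k (suc c ∷ cs) (here _)  x<y = +-mono-<-≤
  (*-monoʳ-< (suc c) (^-monoˡ-< (suc k) x<y)) (evalFromℕ-mono-≤ (suc (suc k)) cs (<⇒≤ x<y))
evalFromℕ-mono-< k (c ∷ cs)     (there p) x<y = +-mono-≤-<
  (*-monoʳ-≤ c (^-monoˡ-≤ (suc k) (<⇒≤ x<y))) (evalFromℕ-mono-< (suc k) cs p x<y)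

evalFromℕ-injective : ∀ k cs → Any (0 <_) cs → Injective _≡_ _≡_ (evalFromℕ (suc k) cs)
evalFromℕ-injective k cs p {x} {y} eq with <-cmp x y
... | tri< x<y _ _ = contradiction eq (<⇒≢ (evalFromℕ-mono-< k cs p x<y))
... | tri≈ _ x≡y _ = x≡y
... | tri> _ _ y<x = contradiction (sym eq) (<⇒≢ (evalFromℕ-mono-< k cs p y<x))

*-congˡ-positive : ∀ a {b c} → (0 < a → b ≡ c) → a * b ≡ a * c
*-congˡ-positive zero    _   = refl
*-congˡ-positive (suc a) b≡c = cong (suc a *_) (b≡c z<s)

-- Counting homomorphisms from digraphs

record Digraph : Set where
  constructor digraph
  field
    order : ℕ
    arc   : Fin order → Fin order → Bool
open Digraph

Pairs : ℕ → Set
Pairs n = List (Fin n × Fin n)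

IsHom : (Z : Digraph) (U : FDDS) → (Fin (order Z) → Fin (size U)) → Set
IsHom Z U h = ∀ x y → T (arc Z x y) → fun U (h x) ≡ h y

Separates : Pairs n → (Fin n → A) → Set
Separates D h = All (λ (x , y) → h x ≢ h y) D

isHom? : (Z : Digraph) (U : FDDS) → Decidable (IsHom Z U)
isHom? Z U h = all? λ x → all? λ y → T? (arc Z x y) →-dec fun U (h x) ≟ h y

separates? : (D : Pairs n) → Decidable (Separates {A = Fin m} D)
separates? D h = All.all? (λ (x , y) → ¬? (h x ≟ h y)) D

IsHom-resp : ∀ {Z U f g} → f ≗ g → IsHom Z U f → IsHom Z U g
IsHom-resp {U = U} f≗g hom x y xy = trans (cong (fun U) (sym (f≗g x))) (trans (hom x y xy) (f≗g y))

Separates-resp : {D : Pairs n} {f g : Fin n → A} → f ≗ g → Separates D f → Separates D g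
Separates-resp f≗g = All.map λ {(x , y)} fx≢fy gx≡gy →
  fx≢fy (trans (f≗g x) (trans gx≡gy (sym (f≗g y))))

-- Homomorphisms are stored as vectors so that they can be counted.  The proof
-- field is irrelevant, so homomorphisms with equal vectors are equal; the
-- proofs are recomputed from the decision procedures when needed.
record Hom≢ (Z : Digraph) (D : Pairs (order Z)) (U : FDDS) : Set where
  constructor vecHom
  field
    vertices : Vec (Fin (size U)) (order Z)
    .valid   : IsHom Z U (lookup vertices) × Separates D (lookup vertices)

Hom : Digraph → FDDS → Set
Hom Z U = Hom≢ Z [] U

finite-Hom≢ : (Z : Digraph) (D : Pairs (order Z)) (U : FDDS) → Finite (Hom≢ Z D U)
finite-Hom≢ Z D U = finite-↔ as-refinement (finite-refinement (finite-Vec finite-Fin (order Z))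
  (λ h → isHom? Z U (lookup h) ×-dec separates? D (lookup h)))
  where
  as-refinement : Hom≢ Z D U ↔ [ h ∈ Vec (Fin (size U)) (order Z) ∣
                                  IsHom Z U (lookup h) × Separates D (lookup h) ]
  as-refinement = mk↔ₛ′ (λ (vecHom h p) → h , [ p ]) (λ (h , [ p ]) → vecHom h p)
    (λ _ → refl) (λ _ → refl)

hom≢ : (Z : Digraph) → Pairs (order Z) → FDDS → ℕ
hom≢ Z D U = card (finite-Hom≢ Z D U)

hom : Digraph → FDDS → ℕ
hom Z U = hom≢ Z [] U

module _ {Z : Digraph} {D : Pairs (order Z)} {U : FDDS} where

  ⟦_⟧ : Hom≢ Z D U → Fin (order Z) → Fin (size U)
  ⟦ h ⟧ = lookup (Hom≢.vertices h)

  isHom : (h : Hom≢ Z D U) → IsHom Z U ⟦ h ⟧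
  isHom (vecHom h p) = recompute (isHom? Z U (lookup h)) (proj₁ p)

  separates : (h : Hom≢ Z D U) → Separates D ⟦ h ⟧
  separates (vecHom h p) = recompute (separates? D (lookup h)) (proj₂ p)

  mkHom≢ : (h : Fin (order Z) → Fin (size U)) → .(IsHom Z U h) → .(Separates D h) → Hom≢ Z D U
  mkHom≢ h hom sep = vecHom (tabulate h) (IsHom-resp {Z} {U} h≗ hom , Separates-resp h≗ sep)
    where
    h≗ : h ≗ lookup (tabulate h)
    h≗ = sym ∘ lookup∘tabulate h

  vertices-injective : {g h : Hom≢ Z D U} → Hom≢.vertices g ≡ Hom≢.vertices h → g ≡ h
  vertices-injective refl = refl

  Hom-ext : {g h : Hom≢ Z D U} → ⟦ g ⟧ ≗ ⟦ h ⟧ → g ≡ h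
  Hom-ext {vecHom g _} {vecHom h _} g≗h = vertices-injective
    (trans (sym (tabulate∘lookup g)) (trans (tabulate-cong g≗h) (tabulate∘lookup h)))

mkHom : ∀ {Z U} (h : Fin (order Z) → Fin (size U)) → .(IsHom Z U h) → Hom Z U
mkHom h hom = mkHom≢ h hom []

IsMorphism : (U V : FDDS) → (Fin (size U) → Fin (size V)) → Set
IsMorphism U V φ = ∀ x → φ (fun U x) ≡ fun V (φ x)

module _ {Z : Digraph} where

  Hom-map : ∀ {U V} (φ : Fin (size U) → Fin (size V)) → IsMorphism U V φ → Hom Z U → Hom Z V
  Hom-map {V = V} φ φ-morphism h = mkHom {Z} {V} (φ ∘ ⟦ h ⟧) λ x y xy →
    trans (sym (φ-morphism (⟦ h ⟧ x))) (cong φ (isHom h x y xy))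

  Hom-map-inverse : ∀ {U V φ ψ} (φ-morphism : IsMorphism U V φ) (ψ-morphism : IsMorphism V U ψ) →
                    (∀ y → φ (ψ y) ≡ y) →
                    ∀ h → Hom-map φ φ-morphism (Hom-map ψ ψ-morphism h) ≡ h
  Hom-map-inverse {φ = φ} _ _ φ∘ψ≗id h = Hom-ext λ x →
    trans (lookup∘tabulate _ x) (trans (cong φ (lookup∘tabulate _ x)) (φ∘ψ≗id (⟦ h ⟧ x)))

  IsHom-reflect : ∀ {U V φ g} {h : Hom Z V} → IsMorphism U V φ → Injective _≡_ _≡_ φ →
                  (∀ x → φ (g x) ≡ ⟦ h ⟧ x) → IsHom Z U g
  IsHom-reflect {U} {V} {φ} {g} {h} φ-morphism φ-injective φ∘g≗h x y xy = φ-injective $ begin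
    φ (fun U (g x))  ≡⟨ φ-morphism (g x) ⟩
    fun V (φ (g x))  ≡⟨ cong (fun V) (φ∘g≗h x) ⟩
    fun V (⟦ h ⟧ x)  ≡⟨ isHom h x y xy ⟩
    ⟦ h ⟧ y          ≡⟨ φ∘g≗h y ⟨
    φ (g y)          ∎
    where open ≡-Reasoning

≅-sym : {U V : FDDS} → U ≅ V → V ≅ U
≅-sym {U} {V} U≅V = record
  { to      = ψ
  ; from    = φ
  ; from∘to = to∘from
  ; to∘from = from∘to
  ; commute = λ y → begin
      ψ (fun V y)            ≡⟨ cong (ψ ∘ fun V) (to∘from y) ⟨
      ψ (fun V (φ (ψ y)))    ≡⟨ cong ψ (commute (ψ y)) ⟨
      ψ (φ (fun U (ψ y)))    ≡⟨ from∘to _ ⟩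
      fun U (ψ y)            ∎
  }
  where
  open _≅_ U≅V renaming (to to φ; from to ψ)
  open ≡-Reasoning

module _ (Z : Digraph) where

  hom-≅ : {U V : FDDS} → U ≅ V → hom Z U ≡ hom Z V
  hom-≅ {U} {V} U≅V = card-cong (finite-Hom≢ Z [] U) (finite-Hom≢ Z [] V) $ mk↔ₛ′
    (Hom-map φ φ-morphism) (Hom-map ψ ψ-morphism)
    (Hom-map-inverse φ-morphism ψ-morphism to∘from) (Hom-map-inverse ψ-morphism φ-morphism from∘to)
    where
    open _≅_ U≅V renaming (to to φ; from to ψ; commute to φ-morphism)
    open _≅_ (≅-sym U≅V) using () renaming (commute to ψ-morphism)

  hom-𝟙 : hom Z 𝟙 ≡ 1
  hom-𝟙 = card-cong (finite-Hom≢ Z [] 𝟙) finite-Fin $ mk↔ₛ′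
    (λ _ → zero) (λ _ → mkHom (λ _ → zero) λ _ _ _ → refl)
    (λ { zero → refl ; (suc ()) }) (λ _ → Hom-ext λ _ → Fin1-unique _ _)
    where
    Fin1-unique : (i j : Fin 1) → i ≡ j
    Fin1-unique zero zero = refl

  hom-𝟘 : Fin (order Z) → hom Z 𝟘 ≡ 0
  hom-𝟘 x = card-cong (finite-Hom≢ Z [] 𝟘) finite-Fin $
    mk↔ₛ′ (λ h → ⟦ h ⟧ x) (λ ()) (λ ()) (λ h → ⊥-elim (Fin0-empty (⟦ h ⟧ x)))
    where
    Fin0-empty : {C : Set} → Fin 0 → C
    Fin0-empty ()

  module _ (U W : FDDS) where
    private
      combine′ : Fin (size U) → Fin (size W) → Fin (size (U ⊗ W))
      combine′ = combine

      π₁ : Fin (size (U ⊗ W)) → Fin (size U)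
      π₁ = proj₁ ∘ remQuot {size U} (size W)
      π₂ : Fin (size (U ⊗ W)) → Fin (size W)
      π₂ = proj₂ ∘ remQuot {size U} (size W)

      π-combine′ : ∀ u w → (π₁ (combine′ u w) , π₂ (combine′ u w)) ≡ (u , w)
      π-combine′ = remQuot-combine

      pair : Hom Z U × Hom Z W → Hom Z (U ⊗ W)
      pair (g , h) = mkHom (λ x → combine′ (⟦ g ⟧ x) (⟦ h ⟧ x)) λ x y xy → begin
        fun (U ⊗ W) (combine′ (⟦ g ⟧ x) (⟦ h ⟧ x))
          ≡⟨ cong (λ (u , w) → combine′ (fun U u) (fun W w)) (π-combine′ _ _) ⟩
        combine′ (fun U (⟦ g ⟧ x)) (fun W (⟦ h ⟧ x))
          ≡⟨ cong₂ combine′ (isHom g x y xy) (isHom h x y xy) ⟩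
        combine′ (⟦ g ⟧ y) (⟦ h ⟧ y)
          ∎
        where open ≡-Reasoning

      unpair : Hom Z (U ⊗ W) → Hom Z U × Hom Z W
      unpair h = Hom-map π₁ (λ _ → cong proj₁ (π-combine′ _ _)) h ,
                 Hom-map π₂ (λ _ → cong proj₂ (π-combine′ _ _)) h

      unpair-pair : ∀ g → unpair (pair g) ≡ g
      unpair-pair (g , h) = cong₂ _,_
        (Hom-ext λ x → trans (lookup∘tabulate _ x)
          (trans (cong π₁ (lookup∘tabulate _ x)) (cong proj₁ (π-combine′ _ _))))
        (Hom-ext λ x → trans (lookup∘tabulate _ x)
          (trans (cong π₂ (lookup∘tabulate _ x)) (cong proj₂ (π-combine′ _ _))))

      pair-unpair : ∀ h → pair (unpair h) ≡ h
      pair-unpair h = Hom-ext λ x → trans (lookup∘tabulate _ x)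
        (trans (cong₂ combine′ (lookup∘tabulate _ x) (lookup∘tabulate _ x)) (combine-remQuot {size U} (size W) _))

    hom-⊗ : hom Z (U ⊗ W) ≡ hom Z U * hom Z W
    hom-⊗ = card-cong (finite-Hom≢ Z [] (U ⊗ W)) (finite-× (finite-Hom≢ Z [] U) (finite-Hom≢ Z [] W)) $
      mk↔ₛ′ unpair pair unpair-pair pair-unpair

point : Digraph
point = digraph 1 λ _ _ → false

hom-point : ∀ U → hom point U ≡ size U
hom-point U = card-cong (finite-Hom≢ point [] U) finite-Fin $ mk↔ₛ′
  (λ h → ⟦ h ⟧ zero) (λ u → mkHom (λ _ → u) λ _ _ ())
  (λ _ → refl) (λ h → Hom-ext λ { zero → refl ; (suc ()) })

hom-empty : ∀ arc U → hom (digraph 0 arc) U ≡ 1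
hom-empty arc U = card-cong (finite-Hom≢ (digraph 0 arc) [] U) finite-Fin $ mk↔ₛ′
  (λ _ → zero) (λ _ → vecHom [] ((λ ()) , []))
  (λ { zero → refl ; (suc ()) }) (λ { (vecHom [] _) → refl })

Compatible : (Z : Digraph) → (Fin (order Z) → Bool) → Set
Compatible Z c = ∀ x y → T (arc Z x y) → c x ≡ c y

record Connected (Z : Digraph) : Set where
  field
    root          : Fin (order Z)
    monochromatic : ∀ c → Compatible Z c → ∀ x → c x ≡ c root

module _ {Z : Digraph} (Z-connected : Connected Z) (U W : FDDS) where
  open Connected Z-connected
  private
    split⊕ : Fin (size (U ⊕ W)) → Fin (size U) ⊎ Fin (size W)
    split⊕ = splitAt (size U)
    join⊕ : Fin (size U) ⊎ Fin (size W) → Fin (size (U ⊕ W))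
    join⊕ = join (size U) (size W)

    ι₁ : Fin (size U) → Fin (size (U ⊕ W))
    ι₁ = join⊕ ∘ inj₁
    ι₂ : Fin (size W) → Fin (size (U ⊕ W))
    ι₂ = join⊕ ∘ inj₂

    ι₁-morphism : IsMorphism U (U ⊕ W) ι₁
    ι₁-morphism u = cong (join⊕ ∘ Sum.map (fun U) (fun W)) (sym (splitAt-join (size U) (size W) (inj₁ u)))
    ι₂-morphism : IsMorphism W (U ⊕ W) ι₂
    ι₂-morphism w = cong (join⊕ ∘ Sum.map (fun U) (fun W)) (sym (splitAt-join (size U) (size W) (inj₂ w)))

    side : Hom Z (U ⊕ W) → Fin (order Z) → Bool
    side h = isLeft ∘ split⊕ ∘ ⟦ h ⟧

    side-compatible : ∀ h → Compatible Z (side h)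
    side-compatible h x y xy = begin
      isLeft (split⊕ (⟦ h ⟧ x))                          ≡⟨ isLeft-map _ ⟨
      isLeft (Sum.map (fun U) (fun W) (split⊕ (⟦ h ⟧ x)))  ≡⟨ cong isLeft (splitAt-join (size U) (size W) _) ⟨
      isLeft (split⊕ (fun (U ⊕ W) (⟦ h ⟧ x)))             ≡⟨ cong (isLeft ∘ split⊕) (isHom h x y xy) ⟩
      isLeft (split⊕ (⟦ h ⟧ y))                          ∎
      where open ≡-Reasoning

    fromSum : Hom Z U ⊎ Hom Z W → Hom Z (U ⊕ W)
    fromSum = [ Hom-map ι₁ ι₁-morphism , Hom-map ι₂ ι₂-morphism ]′

    side-fromSum : ∀ s x → side (fromSum s) x ≡ isLeft s
    side-fromSum (inj₁ _) x =
      trans (cong (isLeft ∘ split⊕) (lookup∘tabulate _ x)) (cong isLeft (splitAt-join (size U) (size W) _))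
    side-fromSum (inj₂ _) x =
      trans (cong (isLeft ∘ split⊕) (lookup∘tabulate _ x)) (cong isLeft (splitAt-join (size U) (size W) _))

    left-factor : ∀ h (left : ∀ x → side h x ≡ true) x →
                  ι₁ (fromLeft (split⊕ (⟦ h ⟧ x)) (left x)) ≡ ⟦ h ⟧ x
    left-factor h left x =
      trans (cong join⊕ (inj₁-fromLeft _ (left x))) (join-splitAt (size U) (size W) _)

    right-factor : ∀ h (right : ∀ x → side h x ≡ false) x →
                   ι₂ (fromRight (split⊕ (⟦ h ⟧ x)) (right x)) ≡ ⟦ h ⟧ x
    right-factor h right x =
      trans (cong join⊕ (inj₂-fromRight _ (right x))) (join-splitAt (size U) (size W) _)

    leftPart : (h : Hom Z (U ⊕ W)) → (∀ x → side h x ≡ true) → Hom Z U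
    leftPart h left =
      mkHom _ (IsHom-reflect {h = h} ι₁-morphism (↑ˡ-injective (size W) _ _) (left-factor h left))

    rightPart : (h : Hom Z (U ⊕ W)) → (∀ x → side h x ≡ false) → Hom Z W
    rightPart h right =
      mkHom _ (IsHom-reflect {h = h} ι₂-morphism (↑ʳ-injective (size U) _ _) (right-factor h right))

    ι₁∘leftPart : ∀ h left x → ι₁ (⟦ leftPart h left ⟧ x) ≡ ⟦ h ⟧ x
    ι₁∘leftPart h left x = trans (cong ι₁ (lookup∘tabulate _ x)) (left-factor h left x)

    ι₂∘rightPart : ∀ h right x → ι₂ (⟦ rightPart h right ⟧ x) ≡ ⟦ h ⟧ x
    ι₂∘rightPart h right x = trans (cong ι₂ (lookup∘tabulate _ x)) (right-factor h right x)

    -- Connectedness makes side h constant, so it is read off at the root.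
    toSum : (h : Hom Z (U ⊕ W)) → ∀ b → side h root ≡ b → Hom Z U ⊎ Hom Z W
    toSum h true  root-left  = inj₁ $ leftPart h λ x →
      trans (monochromatic _ (side-compatible h) x) root-left
    toSum h false root-right = inj₂ $ rightPart h λ x →
      trans (monochromatic _ (side-compatible h) x) root-right

    fromSum-toSum : ∀ h b root-side → fromSum (toSum h b root-side) ≡ h
    fromSum-toSum h true  _ = Hom-ext λ x → trans (lookup∘tabulate _ x) (ι₁∘leftPart h _ x)
    fromSum-toSum h false _ = Hom-ext λ x → trans (lookup∘tabulate _ x) (ι₂∘rightPart h _ x)

    toSum-fromSum : ∀ s b root-side → toSum (fromSum s) b root-side ≡ s
    toSum-fromSum (inj₁ g) true  _ = cong inj₁ $ Hom-ext λ x →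
      ↑ˡ-injective (size W) _ _ (trans (ι₁∘leftPart (fromSum (inj₁ g)) _ x) (lookup∘tabulate _ x))
    toSum-fromSum (inj₂ g) false _ = cong inj₂ $ Hom-ext λ x →
      ↑ʳ-injective (size U) _ _ (trans (ι₂∘rightPart (fromSum (inj₂ g)) _ x) (lookup∘tabulate _ x))
    toSum-fromSum s@(inj₁ _) false root-right = contradiction (trans (sym (side-fromSum s root)) root-right) λ ()
    toSum-fromSum s@(inj₂ _) true  root-left  = contradiction (trans (sym (side-fromSum s root)) root-left) λ ()

  hom-⊕ : hom Z (U ⊕ W) ≡ hom Z U + hom Z W
  hom-⊕ = card-cong (finite-Hom≢ Z [] (U ⊕ W)) (finite-⊎ (finite-Hom≢ Z [] U) (finite-Hom≢ Z [] W)) $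
    mk↔ₛ′ (λ h → toSum h _ refl) fromSum (λ s → toSum-fromSum s _ refl) (λ h → fromSum-toSum h _ refl)

module _ (Z : Digraph) where

  hom-^ : ∀ X k → hom Z (X ^ k) ≡ hom Z X ^ℕ k
  hom-^ X zero    = hom-𝟙 Z
  hom-^ X (suc k) = trans (hom-⊗ Z X (X ^ k)) (cong (hom Z X *_) (hom-^ X k))

  hom-evalFrom : Connected Z → ∀ k As X →
                 hom Z (evalFrom k As X) ≡ evalFromℕ k (map (hom Z) As) (hom Z X)
  hom-evalFrom Z-connected k []       X = hom-𝟘 Z (Connected.root Z-connected)
  hom-evalFrom Z-connected k (A ∷ As) X = begin
    hom Z (A ⊗ X ^ k ⊕ evalFrom (suc k) As X)          ≡⟨ hom-⊕ Z-connected _ _ ⟩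
    hom Z (A ⊗ X ^ k) + hom Z (evalFrom (suc k) As X)  ≡⟨ cong (_ +_) (hom-evalFrom Z-connected (suc k) As X) ⟩
    hom Z (A ⊗ X ^ k) + rest                           ≡⟨ cong (_+ rest) (hom-⊗ Z A (X ^ k)) ⟩
    hom Z A * hom Z (X ^ k) + rest                     ≡⟨ cong (λ n → hom Z A * n + rest) (hom-^ X k) ⟩
    hom Z A * hom Z X ^ℕ k + rest                      ∎
    where
    rest : ℕ
    rest = evalFromℕ (suc k) (map (hom Z) As) (hom Z X)
    open ≡-Reasoning

evalPoly-≅⇒hom≡ : ∀ {Z As A X Y} → Connected Z → A ∈ As → evalPoly As X ≅ evalPoly As Y →
                  0 < hom Z A → hom Z X ≡ hom Z Y
evalPoly-≅⇒hom≡ {Z} {As} {A} {X} {Y} Z-connected A∈As PX≅PY 0<hom-A =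
  evalFromℕ-injective 0 (map (hom Z) As) (lose (∈-map⁺ (hom Z) A∈As) 0<hom-A) $ begin
    evalFromℕ 1 (map (hom Z) As) (hom Z X)  ≡⟨ hom-evalFrom Z Z-connected 1 As X ⟨
    hom Z (evalPoly As X)                   ≡⟨ hom-≅ Z PX≅PY ⟩
    hom Z (evalPoly As Y)                   ≡⟨ hom-evalFrom Z Z-connected 1 As Y ⟩
    evalFromℕ 1 (map (hom Z) As) (hom Z Y)  ∎
  where open ≡-Reasoning

-- Reduction to connected digraphs

induced : (Z : Digraph) → (Fin k → Fin (order Z)) → Digraph
induced {k} Z ι = digraph k λ i j → arc Z (ι i) (ι j)

Hom-restrict : ∀ {Z U} (ι : Fin k → Fin (order Z)) → Hom Z U → Hom (induced Z ι) U
Hom-restrict {Z = Z} {U} ι h = mkHom {induced Z ι} {U} (⟦ h ⟧ ∘ ι) λ i j → isHom h (ι i) (ι j)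

module _ {Z : Digraph} {k₁ k₂} (σ : Fin (order Z) ↔ (Fin k₁ ⊎ Fin k₂))
         (σ-compatible : Compatible Z (isLeft ∘ to σ)) (U : FDDS) where
  private
    Z₁ Z₂ : Digraph
    Z₁ = induced Z (from σ ∘ inj₁)
    Z₂ = induced Z (from σ ∘ inj₂)

    same-side : ∀ s t → T (arc Z (from σ s) (from σ t)) → isLeft s ≡ isLeft t
    same-side s t st = begin
      isLeft s                  ≡⟨ cong isLeft (strictlyInverseˡ σ s) ⟨
      isLeft (to σ (from σ s))  ≡⟨ σ-compatible _ _ st ⟩
      isLeft (to σ (from σ t))  ≡⟨ cong isLeft (strictlyInverseˡ σ t) ⟩
      isLeft t                  ∎
      where open ≡-Reasoning

    glue-isHom : ∀ (g₁ : Hom Z₁ U) (g₂ : Hom Z₂ U) s t → T (arc Z (from σ s) (from σ t)) →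
                 fun U ([ ⟦ g₁ ⟧ , ⟦ g₂ ⟧ ]′ s) ≡ [ ⟦ g₁ ⟧ , ⟦ g₂ ⟧ ]′ t
    glue-isHom g₁ g₂ (inj₁ i) (inj₁ j) ij = isHom g₁ i j ij
    glue-isHom g₁ g₂ (inj₂ i) (inj₂ j) ij = isHom g₂ i j ij
    glue-isHom g₁ g₂ s@(inj₁ _) t@(inj₂ _) st = contradiction (same-side s t st) λ ()
    glue-isHom g₁ g₂ s@(inj₂ _) t@(inj₁ _) st = contradiction (same-side s t st) λ ()

    glue : Hom Z₁ U × Hom Z₂ U → Hom Z U
    glue (g₁ , g₂) = mkHom ([ ⟦ g₁ ⟧ , ⟦ g₂ ⟧ ]′ ∘ to σ) λ x y xy →
      glue-isHom g₁ g₂ (to σ x) (to σ y)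
        (subst₂ (λ x y → T (arc Z x y)) (sym (strictlyInverseʳ σ x)) (sym (strictlyInverseʳ σ y)) xy)

    restrict : Hom Z U → Hom Z₁ U × Hom Z₂ U
    restrict h = Hom-restrict _ h , Hom-restrict _ h

    restrict-glue : ∀ g → restrict (glue g) ≡ g
    restrict-glue (g₁ , g₂) = cong₂ _,_ (Hom-ext (at inj₁)) (Hom-ext (at inj₂))
      where
      at : ∀ {k} (inj : Fin k → Fin k₁ ⊎ Fin k₂) i →
           lookup (tabulate (⟦ glue (g₁ , g₂) ⟧ ∘ from σ ∘ inj)) i ≡ [ ⟦ g₁ ⟧ , ⟦ g₂ ⟧ ]′ (inj i)
      at inj i = trans (lookup∘tabulate _ i) $ trans (lookup∘tabulate _ (from σ (inj i)))
        (cong [ ⟦ g₁ ⟧ , ⟦ g₂ ⟧ ]′ (strictlyInverseˡ σ (inj i)))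

    glue-restrict : ∀ h → glue (restrict h) ≡ h
    glue-restrict h = Hom-ext λ x → trans (lookup∘tabulate _ x)
      (trans (restrict-at (to σ x)) (cong ⟦ h ⟧ (strictlyInverseʳ σ x)))
      where
      restrict-at : ∀ s → [ ⟦ Hom-restrict _ h ⟧ , ⟦ Hom-restrict _ h ⟧ ]′ s ≡ ⟦ h ⟧ (from σ s)
      restrict-at (inj₁ i) = lookup∘tabulate _ i
      restrict-at (inj₂ i) = lookup∘tabulate _ i

  hom-split : hom Z U ≡ hom (induced Z (from σ ∘ inj₁)) U * hom (induced Z (from σ ∘ inj₂)) U
  hom-split = card-cong (finite-Hom≢ Z [] U) (finite-× (finite-Hom≢ Z₁ [] U) (finite-Hom≢ Z₂ [] U)) $
    mk↔ₛ′ restrict glue restrict-glue glue-restrict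

record Splitting (Z : Digraph) : Set where
  field
    k₁ k₂      : ℕ
    σ          : Fin (order Z) ↔ (Fin (suc k₁) ⊎ Fin (suc k₂))
    compatible : Compatible Z (isLeft ∘ to σ)

  order≡ : order Z ≡ suc k₁ + suc k₂
  order≡ = card-cong finite-Fin (finite-⊎ finite-Fin finite-Fin) σ

  left-smaller : suc k₁ < order Z
  left-smaller = subst (suc k₁ <_) (sym order≡) (m<m+n (suc k₁) z<s)

  right-smaller : suc k₂ < order Z
  right-smaller = subst (suc k₂ <_) (sym order≡) (m<n+m (suc k₂) z<s)

Bichromatic : (Z : Digraph) → (Fin (order Z) → Bool) → Set
Bichromatic Z c = Compatible Z c × ∃ (λ x → c x ≡ true) × ∃ (λ y → c y ≡ false)

bichromatic? : (Z : Digraph) → Decidable (Bichromatic Z)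
bichromatic? Z c = (all? λ x → all? λ y → T? (arc Z x y) →-dec c x ≟ᵇ c y)
            ×-dec any? (λ x → c x ≟ᵇ true) ×-dec any? (λ y → c y ≟ᵇ false)

Bichromatic-resp : ∀ {Z c d} → c ≗ d → Bichromatic Z c → Bichromatic Z d
Bichromatic-resp c≗d (compatible , (x , cx) , (y , cy)) =
  (λ x y xy → trans (sym (c≗d x)) (trans (compatible x y xy) (c≗d y))) ,
  (x , trans (sym (c≗d x)) cx) , (y , trans (sym (c≗d y)) cy)

bichromatic⇒splitting : ∀ {Z c} → Bichromatic Z c → Splitting Z
bichromatic⇒splitting {Z} {c} (compatible , (x , cx) , (y , cy)) = record
  { k₁ = proj₁ left ; k₂ = proj₁ right ; σ = σ
  ; compatible = λ u v uv → trans (isLeft-σ u) (trans (compatible u v uv) (sym (isLeft-σ v)))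
  }
  where
  left : ∃[ k ] [ u ∈ Fin (order Z) ∣ c u ≡ true ] ↔ Fin (suc k)
  left = finite-inhabited (finite-refinement-Fin (λ u → c u ≟ᵇ true)) (x , [ cx ])
  right : ∃[ k ] [ u ∈ Fin (order Z) ∣ c u ≡ false ] ↔ Fin (suc k)
  right = finite-inhabited (finite-refinement-Fin (λ u → c u ≟ᵇ false)) (y , [ cy ])

  σ : Fin (order Z) ↔ (Fin (suc (proj₁ left)) ⊎ Fin (suc (proj₁ right)))
  σ = ↔-trans (partition-↔ c) (proj₂ left ⊎-↔ proj₂ right)

  isLeft-σ : ∀ u → isLeft (to σ u) ≡ c u
  isLeft-σ u = trans (isLeft-map (to (partition-↔ c) u)) (isLeft-partition c u)

connected-or-splitting : (Z : Digraph) → Fin (order Z) → Connected Z ⊎ Splitting Z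
connected-or-splitting Z r
  with any?-finite (finite-Vec (2 , ↔-sym 2↔Bool) (order Z)) (bichromatic? Z ∘ lookup)
... | yes (_ , bichromatic) = inj₂ (bichromatic⇒splitting bichromatic)
... | no ¬bichromatic       = inj₁ record { root = r ; monochromatic = monochromatic }
  where
  not-bichromatic : ∀ c → ¬ Bichromatic Z c
  not-bichromatic c bichromatic =
    ¬bichromatic (tabulate c , Bichromatic-resp (sym ∘ lookup∘tabulate c) bichromatic)

  monochromatic : ∀ c → Compatible Z c → ∀ x → c x ≡ c r
  monochromatic c compatible x with c x in cx | c r in cr
  ... | true  | true  = refl
  ... | false | false = refl
  ... | true  | false = ⊥-elim (not-bichromatic c (compatible , (x , cx) , (r , cr)))
  ... | false | true  = ⊥-elim (not-bichromatic c (compatible , (r , cr) , (x , cx)))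

module _ {U V : FDDS} (connected-counts : ∀ Z → Connected Z → hom Z U ≡ hom Z V) where

  connected-counts⇒counts : ∀ Z → hom Z U ≡ hom Z V
  connected-counts⇒counts (digraph n arc) = <-rec P counts n arc
    where
    P : ℕ → Set
    P n = ∀ arc → hom (digraph n arc) U ≡ hom (digraph n arc) V

    counts : ∀ n → (∀ {m} → m < n → P m) → P n
    counts zero    _       arc = trans (hom-empty arc U) (sym (hom-empty arc V))
    counts (suc n) smaller arc with connected-or-splitting (digraph (suc n) arc) zero
    ... | inj₁ connected = connected-counts _ connected
    ... | inj₂ split     = begin
      hom Z U               ≡⟨ hom-split σ compatible U ⟩
      hom Z₁ U * hom Z₂ U   ≡⟨ cong₂ _*_ (smaller left-smaller _) (smaller right-smaller _) ⟩
      hom Z₁ V * hom Z₂ V   ≡⟨ hom-split σ compatible V ⟨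
      hom Z V               ∎
      where
      open Splitting split
      open ≡-Reasoning
      Z Z₁ Z₂ : Digraph
      Z  = digraph (suc n) arc
      Z₁ = induced Z (from σ ∘ inj₁)
      Z₂ = induced Z (from σ ∘ inj₂)

-- Lovász's theorem

image : (Z : Digraph) → (Fin (order Z) → Fin n) → Digraph
image {n} Z q = digraph n λ i j →
  ⌊ any? (λ x → any? λ y → q x ≟ i ×-dec q y ≟ j ×-dec T? (arc Z x y)) ⌋

module _ {Z : Digraph} {q : Fin (order Z) → Fin n} {U : FDDS} {h : Fin n → Fin (size U)} where

  IsHom-image : IsHom Z U (h ∘ q) → IsHom (image Z q) U h
  IsHom-image hom i j ij with (x , y , refl , refl , xy) ← toWitness ij = hom x y xy

  IsHom-image⁻ : IsHom (image Z q) U h → IsHom Z U (h ∘ q)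
  IsHom-image⁻ hom x y xy = hom (q x) (q y) (fromWitness (x , y , refl , refl , xy))

module Contraction {n} (a b : Fin (suc n)) (a≢b : a ≢ b) where

  -- squash sends b to the image of a and inverts punchIn b elsewhere.
  squash : Fin (suc n) → Fin n
  squash x with b ≟ x
  ... | yes _  = punchOut (a≢b ∘ sym)
  ... | no b≢x = punchOut b≢x

  squash-punchIn : ∀ i → squash (punchIn b i) ≡ i
  squash-punchIn i with b ≟ punchIn b i
  ... | yes b≡ = contradiction (sym b≡) (punchInᵢ≢i b i)
  ... | no _   = trans (punchOut-cong b refl) (punchOut-punchIn b)

  squash-a≡squash-b : squash a ≡ squash b
  squash-a≡squash-b with b ≟ a | b ≟ b
  ... | yes b≡a | _      = contradiction (sym b≡a) a≢b
  ... | no _    | yes _  = punchOut-cong b refl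
  ... | no _    | no b≢b = contradiction refl b≢b

  punchIn-squash : ∀ (h : Fin (suc n) → A) → h a ≡ h b → h ∘ punchIn b ∘ squash ≗ h
  punchIn-squash h ha≡hb x with b ≟ x
  ... | yes refl = trans (cong h (punchIn-punchOut _)) ha≡hb
  ... | no b≢x   = cong h (punchIn-punchOut b≢x)

  module _ (arc : Fin (suc n) → Fin (suc n) → Bool) (D : Pairs (suc n)) (U : FDDS) where
    private
      Z Z/ab : Digraph
      Z    = digraph (suc n) arc
      Z/ab = image Z squash
      D/ab : Pairs n
      D/ab = map (Product.map squash squash) D

      forget : Hom≢ Z ((a , b) ∷ D) U → Hom≢ Z D U
      forget (vecHom h valid) = vecHom h (Product.map₂ All.tail valid)

      expand : Hom≢ Z/ab D/ab U → Hom≢ Z D U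
      expand h = mkHom≢ (⟦ h ⟧ ∘ squash) (IsHom-image⁻ {Z = Z} {U = U} (isHom h)) (map⁻ (separates h))

      contract : (h : Hom≢ Z D U) → ⟦ h ⟧ a ≡ ⟦ h ⟧ b → Hom≢ Z/ab D/ab U
      contract h ha≡hb = mkHom≢ (⟦ h ⟧ ∘ punchIn b)
        (IsHom-image {Z = Z} {U = U} (IsHom-resp {Z} {U} h≗ (isHom h)))
        (map⁺ (Separates-resp h≗ (separates h)))
        where
        h≗ : ⟦ h ⟧ ≗ ⟦ h ⟧ ∘ punchIn b ∘ squash
        h≗ = sym ∘ punchIn-squash ⟦ h ⟧ ha≡hb

      merge : Hom≢ Z ((a , b) ∷ D) U ⊎ Hom≢ Z/ab D/ab U → Hom≢ Z D U
      merge = [ forget , expand ]′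

      split : (h : Hom≢ Z D U) → Dec (⟦ h ⟧ a ≡ ⟦ h ⟧ b) → Hom≢ Z ((a , b) ∷ D) U ⊎ Hom≢ Z/ab D/ab U
      split h (yes ha≡hb) = inj₂ (contract h ha≡hb)
      split h (no ha≢hb)  = inj₁ (vecHom (Hom≢.vertices h) (isHom h , ha≢hb ∷ separates h))

      merge-split : ∀ h d → merge (split h d) ≡ h
      merge-split h (yes ha≡hb) = Hom-ext λ x →
        trans (lookup∘tabulate (⟦ contract h ha≡hb ⟧ ∘ squash) x)
          (trans (lookup∘tabulate (⟦ h ⟧ ∘ punchIn b) (squash x)) (punchIn-squash ⟦ h ⟧ ha≡hb x))
      merge-split h (no _)      = refl

      split-merge : ∀ s d → split (merge s) d ≡ s
      split-merge (inj₁ h) (yes ha≡hb) = contradiction ha≡hb (All.head (separates h))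
      split-merge (inj₁ h) (no _)      = refl
      split-merge (inj₂ h) (yes _)     = cong inj₂ $ Hom-ext λ i →
        trans (lookup∘tabulate (⟦ expand h ⟧ ∘ punchIn b) i)
          (trans (lookup∘tabulate (⟦ h ⟧ ∘ squash) (punchIn b i)) (cong ⟦ h ⟧ (squash-punchIn i)))
      split-merge (inj₂ h) (no ha≢hb)  = contradiction
        (trans (lookup∘tabulate (⟦ h ⟧ ∘ squash) a)
          (trans (cong ⟦ h ⟧ squash-a≡squash-b) (sym (lookup∘tabulate (⟦ h ⟧ ∘ squash) b)))) ha≢hb

    hom≢-delete-contract : hom≢ Z D U ≡ hom≢ Z ((a , b) ∷ D) U + hom≢ Z/ab D/ab U
    hom≢-delete-contract =
      card-cong (finite-Hom≢ Z D U) (finite-⊎ (finite-Hom≢ Z _ U) (finite-Hom≢ Z/ab D/ab U)) $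
        mk↔ₛ′ (λ h → split h (⟦ h ⟧ a ≟ ⟦ h ⟧ b)) merge
          (λ s → split-merge s (⟦ merge s ⟧ a ≟ ⟦ merge s ⟧ b))
          (λ h → merge-split h (⟦ h ⟧ a ≟ ⟦ h ⟧ b))

hom≢-diagonal : ∀ Z a D U → hom≢ Z ((a , a) ∷ D) U ≡ 0
hom≢-diagonal Z a D U =
  card-cong (finite-Hom≢ Z _ U) finite-Fin $ mk↔ₛ′ absurd (λ ()) (λ ()) (λ h → absurd h)
  where
  absurd : {C : Set} → Hom≢ Z ((a , a) ∷ D) U → C
  absurd h = ⊥-elim (All.head (separates h) refl)

module _ {U V : FDDS} where

  separated-counts-∷ : ∀ {n} arc a b D → let Z = digraph (suc n) arc in
                       hom≢ Z D U ≡ hom≢ Z D V →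
                       (∀ arc′ D′ → hom≢ (digraph n arc′) D′ U ≡ hom≢ (digraph n arc′) D′ V) →
                       hom≢ Z ((a , b) ∷ D) U ≡ hom≢ Z ((a , b) ∷ D) V
  separated-counts-∷ {n} arc a b D D-counts smaller-counts with a ≟ b
  ... | yes refl = trans (hom≢-diagonal _ a D U) (sym (hom≢-diagonal _ a D V))
  ... | no a≢b   = +-cancelʳ-≡ (hom≢ Z/ab D/ab U) _ _ $ begin
    hom≢ Z ((a , b) ∷ D) U + hom≢ Z/ab D/ab U   ≡⟨ hom≢-delete-contract arc D U ⟨
    hom≢ Z D U                                 ≡⟨ D-counts ⟩
    hom≢ Z D V                                 ≡⟨ hom≢-delete-contract arc D V ⟩
    hom≢ Z ((a , b) ∷ D) V + hom≢ Z/ab D/ab V   ≡⟨ cong (_ +_) (smaller-counts _ D/ab) ⟨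
    hom≢ Z ((a , b) ∷ D) V + hom≢ Z/ab D/ab U   ∎
    where
    open Contraction a b a≢b
    open ≡-Reasoning
    Z Z/ab : Digraph
    Z    = digraph (suc n) arc
    Z/ab = image Z squash
    D/ab : Pairs n
    D/ab = map (Product.map squash squash) D

  module _ (same-counts : ∀ Z → hom Z U ≡ hom Z V) where
    private
      separated : ∀ n arc D → hom≢ (digraph n arc) D U ≡ hom≢ (digraph n arc) D V
      separated n       arc []            = same-counts (digraph n arc)
      separated zero    arc ((() , _) ∷ _)
      separated (suc n) arc ((a , b) ∷ D) =
        separated-counts-∷ arc a b D (separated (suc n) arc D) (separated n)

    counts⇒separated-counts : ∀ Z D → hom≢ Z D U ≡ hom≢ Z D V
    counts⇒separated-counts Z = separated (order Z) (arc Z)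

graph : FDDS → Digraph
graph U = digraph (size U) λ x y → ⌊ fun U x ≟ y ⌋

distinct? : (p : Fin n × Fin n) → Dec (proj₁ p ≢ proj₂ p)
distinct? (x , y) = ¬? (x ≟ y)

allPairs : ∀ n → Pairs n
allPairs n = cartesianProduct (allFin n) (allFin n)

distinctPairs : ∀ n → Pairs n
distinctPairs n = filter distinct? (allPairs n)

Separates-distinctPairs⇒injective : {f : Fin n → A} →
                                    Separates (distinctPairs n) f → Injective _≡_ _≡_ f
Separates-distinctPairs⇒injective separated {x} {y} fx≡fy with x ≟ y
... | yes x≡y = x≡y
... | no x≢y  = contradiction fx≡fy $
  All.lookup separated (∈-filter⁺ distinct? (∈-cartesianProduct⁺ (∈-allFin x) (∈-allFin y)) x≢y)

counts⇒≅ : {U V : FDDS} → (∀ Z → hom Z U ≡ hom Z V) → U ≅ V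
counts⇒≅ {U} {V} same-counts = record
  { to      = φ
  ; from    = ψ
  ; from∘to = λ x → φ-injective (proj₂ (φ-surjective (φ x)))
  ; to∘from = λ y → proj₂ (φ-surjective y)
  ; commute = λ x → sym (isHom φ-hom x (fun U x) (fromWitness refl))
  }
  where
  Z : Digraph
  Z = graph U
  D : Pairs (size U)
  D = distinctPairs (size U)

  identity : Hom≢ Z D U
  identity = mkHom≢ {Z} {D} {U} (λ x → x) (λ x y → toWitness) (all-filter distinct? (allPairs (size U)))

  φ-hom : Hom≢ Z D V
  φ-hom = to (card-≡⇒↔ (finite-Hom≢ Z D U) (finite-Hom≢ Z D V)
               (counts⇒separated-counts {U} {V} same-counts Z D))
             identity

  φ : Fin (size U) → Fin (size V)
  φ = ⟦ φ-hom ⟧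

  φ-injective : Injective _≡_ _≡_ φ
  φ-injective = Separates-distinctPairs⇒injective (separates φ-hom)

  φ-surjective : ∀ y → ∃ λ x → φ x ≡ y
  φ-surjective = injective⇒surjective φ-injective $
    ≤-reflexive (trans (sym (hom-point V)) (trans (sym (same-counts point)) (hom-point U)))

  ψ : Fin (size V) → Fin (size U)
  ψ = proj₁ ∘ φ-surjective

lemma6 : (As : List FDDS) → Any Cancelable As →
         (X Y : FDDS) → evalPoly As X ≅ evalPoly As Y → X ≅ Y
lemma6 As cancelable X Y PX≅PY with find cancelable
... | A , A∈As , A-cancelable =
  A-cancelable X Y (counts⇒≅ (connected-counts⇒counts {A ⊗ X} {A ⊗ Y} connected-counts))
  where
  connected-counts : ∀ Z → Connected Z → hom Z (A ⊗ X) ≡ hom Z (A ⊗ Y)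
  connected-counts Z Z-connected = begin
    hom Z (A ⊗ X)      ≡⟨ hom-⊗ Z A X ⟩
    hom Z A * hom Z X  ≡⟨ *-congˡ-positive (hom Z A) (evalPoly-≅⇒hom≡ Z-connected A∈As PX≅PY) ⟩
    hom Z A * hom Z Y  ≡⟨ hom-⊗ Z A Y ⟨
    hom Z (A ⊗ Y)      ∎
    where open ≡-Reasoning
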